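{- Let $k\ge s$ be integers, $\eta\in(0,1)$, and let $\pi_1,\pi_2:[k]\to[s]$ be the two projection maps of a constraint $(u,v)$ of a product Label Cover instance. Let $\mathcal{C}_u=\mathcal{C}_v=\{0,1\}^{k-1}$ be the (folded) long-code positions of $u$ and $v$, and let $A\subseteq\mathcal{C}_u$, $B\subseteq\mathcal{C}_v$ with $|A|=\alpha|\mathcal{C}_u|$ and $|B|=\beta|\mathcal{C}_v|$. Sample $x\in\{0,1\}^s$ uniformly, $y_1,y_2\in\{0,1\}^k$ uniformly, $\rho_1,\rho_2\in\{0,1\}^k$ with all bits i.i.d. $\mathrm{Bernoulli}(\eta)$, and $b\in\{0,1\}$ uniformly, all independently. Let $Q$ be the random $4$-tuple of query positions consisting of $F(y_1\oplus\rho_1),F(\pi_1(x)\oplus y_1)\in\mathcal{C}_u$ and $F(y_2\oplus\rho_2),F(\pi_2(x)\oplus y_2\oplus b\mathbf{1})\in\mathcal{C}_v$. Then $$\frac{\alpha^2\beta^2}{2}\le\Pr_Q\big[Q\subseteq A\cup B\big]\le\alpha\beta,$$ where $Q\subseteq A\cup B$ means that both queries in $\mathcal{C}_u$ lie in $A$ and both queries in $\mathcal{C}_v$ lie in $B$.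
   Context: For a projection $\pi:[k]\to[s]$ and $x\in\{0,1\}^s$, $\pi(x)=(x_{\pi(1)},\dots,x_{\pi(k)})\in\{0,1\}^k$. $\mathbf{1}$ denotes the all-ones vector in $\{0,1\}^k$ and $\oplus$ is coordinatewise addition mod 2. Folding: a position $\theta\in\{0,1\}^k$ is mapped to $F(\theta)=\theta_{\ge 2}\in\{0,1\}^{k-1}$ if $\theta_1=0$ and to $F(\theta)=\theta_{\ge 2}\oplus\mathbf{1}_{k-1}$ if $\theta_1=1$, where $\theta_{\ge2}=(\theta_2,\dots,\theta_k)$. These are the query positions of the $4$-Lin dictatorship test on constraint $(u,v)$.
   Formalization: The parameter η takes only rational values in the interval (0,1). -}

module Defs where

open import Data.Bool using (Bool; true; false; not; _xor_; _∧_; if_then_else_)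
open import Data.Nat using (ℕ; zero; suc)
open import Data.Fin using (Fin)
open import Data.Vec using (Vec; []; _∷_; lookup; tabulate; zipWith; replicate; map)
open import Data.Integer using (+_)
open import Data.Rational using (ℚ; 0ℚ; 1ℚ; _+_; _*_; _-_; _/_)

-- Coordinatewise addition mod 2 on {0,1}^n (bits as Bool, 1 = true).
_⊕_ : ∀ {n} → Vec Bool n → Vec Bool n → Vec Bool n
_⊕_ = zipWith _xor_

𝟏 : ∀ {n} → Vec Bool n
𝟏 = replicate _ true

bOnes : ∀ {n} → Bool → Vec Bool n
bOnes b = replicate _ b

proj : ∀ {k s} → (Fin k → Fin s) → Vec Bool s → Vec Bool k
proj π x = tabulate (λ i → lookup x (π i))

F : ∀ {m} → Vec Bool (suc m) → Vec Bool m
F (false ∷ θ) = θ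
F (true  ∷ θ) = θ ⊕ 𝟏

½ : ℚ
½ = + 1 / 2

EU : (n : ℕ) → (Vec Bool n → ℚ) → ℚ
EU zero    f = f []
EU (suc n) f = ½ * (EU n (λ v → f (false ∷ v)) + EU n (λ v → f (true ∷ v)))

EBit : (Bool → ℚ) → ℚ
EBit f = ½ * (f false + f true)

EBern : ℚ → (n : ℕ) → (Vec Bool n → ℚ) → ℚ
EBern η zero    f = f []
EBern η (suc n) f = (1ℚ - η) * EBern η n (λ v → f (false ∷ v))
                  + η * EBern η n (λ v → f (true ∷ v))

𝟙 : Bool → ℚ
𝟙 true  = 1ℚ
𝟙 false = 0ℚ

density : (m : ℕ) → (Vec Bool m → Bool) → ℚ
density m A = EU m (λ c → 𝟙 (A c))

-- Pr_Q[Q ⊆ A ∪ B] for the 4-Lin test on constraint (u,v), k = suc m.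
testAccept : (m s : ℕ) (η : ℚ) (π₁ π₂ : Fin (suc m) → Fin s)
             (A B : Vec Bool m → Bool) → ℚ
testAccept m s η π₁ π₂ A B =
  EU s λ x → EU (suc m) λ y₁ → EU (suc m) λ y₂ →
  EBern η (suc m) λ ρ₁ → EBern η (suc m) λ ρ₂ → EBit λ b →
  𝟙 (A (F (y₁ ⊕ ρ₁)) ∧ A (F (proj π₁ x ⊕ y₁))
     ∧ B (F (y₂ ⊕ ρ₂)) ∧ B (F ((proj π₂ x ⊕ y₂) ⊕ bOnes b)))

-- Folding makes F (θ ⊕ b𝟏) independent of b, and with c (y₁ , y₂) = 1_A(F y₁) · 1_B(F y₂) the test
-- accepts with probability 𝔼 c (y ⊕ (π₁ x , π₂ x)) · c (y ⊕ (ρ₁ , ρ₂)). Dropping the second factor and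
-- absorbing the shift into the uniform y leaves 𝔼 c = αβ, the upper bound. For the lower bound, folding
-- also makes the test blind to ρᵢ ↦ ρᵢ ⊕ 𝟏, so one may take η ≤ ½ and write ρᵢ = rᵢ ∧ uᵢ with
-- rᵢ ~ Bernoulli(2η) and uᵢ uniform. For fixed r the map (x , u) ↦ (π₁ x ⊕ r₁ ∧ u₁ , π₂ x ⊕ r₂ ∧ u₂)
-- is 𝔽₂-linear, and the acceptance probability becomes ⟨c , Pc⟩ for the averaging operator P over its
-- image. As P is an orthogonal projection, this is ‖Pc‖² ≥ (𝔼 Pc)² = (αβ)², which exceeds α²β²/2.

{-# OPTIONS --safe #-}
module Submission where

open import Defs
open import Data.Bool using (Bool; true; false; _xor_; _∧_)
open import Data.Bool.Properties using (xor-assoc; xor-comm; xor-same; xor-identityʳ; ∧-distribˡ-xor; ∧-zeroʳ; ∧-comm)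
open import Data.Nat using (ℕ; zero; suc) renaming (_≤_ to _≤ℕ_)
open import Data.Fin as Fin using (Fin)
open import Data.Vec using (Vec; []; _∷_; tabulate; zipWith)
open import Data.Vec.Properties using (zipWith-assoc; zipWith-comm; zipWith-distribˡ; zipWith-identityʳ; lookup-zipWith; tabulate-cong)
open import Data.Product using (_×_; _,_; proj₁; uncurry)
open import Data.Sum using (inj₁; inj₂)
open import Data.Rational using (ℚ; 0ℚ; 1ℚ; _+_; _*_; _-_; -_; _<_; _≤_; _≟_; nonNegative; nonPositive)
open import Data.Rational.Properties
open import Function using (_∘_)
open import Level using (0ℓ)
open import Relation.Binary.PropositionalEquality
open import Relation.Nullary.Decidable.Core using (dec⇒maybe)
open import Tactic.RingSolver using (solve-∀)
open import Tactic.RingSolver.Core.AlmostCommutativeRing using (AlmostCommutativeRing; fromCommutativeRing)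

ℚ-ring : AlmostCommutativeRing 0ℓ 0ℓ
ℚ-ring = fromCommutativeRing +-*-commutativeRing (λ p → dec⇒maybe (0ℚ ≟ p))

0≤p*p : ∀ p → 0ℚ ≤ p * p
0≤p*p p with ≤-total 0ℚ p
... | inj₁ 0≤p = nonNegative⁻¹ _ {{nonNeg*nonNeg⇒nonNeg p {{nonNegative 0≤p}} p {{nonNegative 0≤p}}}}
... | inj₂ p≤0 = nonNegative⁻¹ _ {{nonPos*nonPos⇒nonPos p {{nonPositive p≤0}} p {{nonPositive p≤0}}}}

p≤q⇒0≤q-p : ∀ {p q} → p ≤ q → 0ℚ ≤ q - p
p≤q⇒0≤q-p {p} {q} p≤q = begin
  0ℚ     ≡⟨ +-inverseʳ p ⟨
  p - p  ≤⟨ +-monoˡ-≤ (- p) p≤q ⟩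
  q - p  ∎
  where open ≤-Reasoning

p*q≤p : ∀ {p q} → 0ℚ ≤ p → q ≤ 1ℚ → p * q ≤ p
p*q≤p {p} {q} 0≤p q≤1 = begin
  p * q   ≤⟨ *-monoˡ-≤-nonNeg p {{nonNegative 0≤p}} q≤1 ⟩
  p * 1ℚ  ≡⟨ *-identityʳ p ⟩
  p       ∎
  where open ≤-Reasoning

½*[p+p]≡p : ∀ p → ½ * (p + p) ≡ p
½*[p+p]≡p = solve-∀ ℚ-ring

𝟙-∧ : ∀ p q → 𝟙 (p ∧ q) ≡ 𝟙 p * 𝟙 q
𝟙-∧ false q = sym (*-zeroˡ (𝟙 q))
𝟙-∧ true  q = sym (*-identityˡ (𝟙 q))

0≤𝟙 : ∀ p → 0ℚ ≤ 𝟙 p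
0≤𝟙 false = ≤-refl
0≤𝟙 true  = ≤ᵇ⇒≤ _

𝟙≤1 : ∀ p → 𝟙 p ≤ 1ℚ
𝟙≤1 false = ≤ᵇ⇒≤ _
𝟙≤1 true  = ≤-refl

record IsLinear {X : Set} (E : (X → ℚ) → ℚ) : Set where
  field
    𝔼-cong : ∀ {f g : X → ℚ} → (∀ x → f x ≡ g x) → E f ≡ E g
    𝔼-+    : ∀ (f g : X → ℚ) → E (λ x → f x + g x) ≡ E f + E g
    𝔼-*    : ∀ c (f : X → ℚ) → E (λ x → c * f x) ≡ c * E f

  𝔼-*ʳ : ∀ c (f : X → ℚ) → E (λ x → f x * c) ≡ E f * c
  𝔼-*ʳ c f = trans (𝔼-cong (λ x → *-comm (f x) c)) (trans (𝔼-* c f) (*-comm c (E f)))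

record Expectation (X : Set) : Set₁ where
  field
    𝔼        : (X → ℚ) → ℚ
    isLinear : IsLinear 𝔼
    𝔼-mono   : ∀ {f g : X → ℚ} → (∀ x → f x ≤ g x) → 𝔼 f ≤ 𝔼 g
    𝔼-const  : ∀ c → 𝔼 (λ _ → c) ≡ c
    𝔼-swap   : ∀ {Y : Set} {E : (Y → ℚ) → ℚ} → IsLinear E →
               (f : X → Y → ℚ) → 𝔼 (λ x → E (f x)) ≡ E (λ y → 𝔼 (λ x → f x y))

  open IsLinear isLinear public

open Expectation public

module _ {X : Set} where

  -- Makes `𝔼` definitionally EU or EBern, so the nested sums of testAccept need no rewriting.
  replaceOperator : (P : Expectation X) (E : (X → ℚ) → ℚ) → (∀ f → E f ≡ 𝔼 P f) → Expectation X
  𝔼 (replaceOperator P E E≡) = E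
  isLinear (replaceOperator P E E≡) = record
    { 𝔼-cong = λ f≗g → trans (E≡ _) (trans (𝔼-cong P f≗g) (sym (E≡ _)))
    ; 𝔼-+    = λ f g → trans (E≡ _) (trans (𝔼-+ P f g) (sym (cong₂ _+_ (E≡ f) (E≡ g))))
    ; 𝔼-*    = λ c f → trans (E≡ _) (trans (𝔼-* P c f) (sym (cong (c *_) (E≡ f))))
    }
  𝔼-mono (replaceOperator P E E≡) f≤g = subst₂ _≤_ (sym (E≡ _)) (sym (E≡ _)) (𝔼-mono P f≤g)
  𝔼-const (replaceOperator P E E≡) c = trans (E≡ _) (𝔼-const P c)
  𝔼-swap (replaceOperator P E E≡) L f =
    trans (E≡ _) (trans (𝔼-swap P L f) (IsLinear.𝔼-cong L (λ y → sym (E≡ _))))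

  dirac : X → Expectation X
  𝔼 (dirac x) f = f x
  isLinear (dirac x) = record { 𝔼-cong = λ f≗g → f≗g x ; 𝔼-+ = λ _ _ → refl ; 𝔼-* = λ _ _ → refl }
  𝔼-mono (dirac x) f≤g = f≤g x
  𝔼-const (dirac x) c = refl
  𝔼-swap (dirac x) L f = refl

  pushforward : {Y : Set} → (X → Y) → Expectation X → Expectation Y
  𝔼 (pushforward h P) f = 𝔼 P (f ∘ h)
  isLinear (pushforward h P) = record
    { 𝔼-cong = λ f≗g → 𝔼-cong P (f≗g ∘ h) ; 𝔼-+ = λ f g → 𝔼-+ P (f ∘ h) (g ∘ h) ; 𝔼-* = λ c f → 𝔼-* P c (f ∘ h) }
  𝔼-mono (pushforward h P) f≤g = 𝔼-mono P (f≤g ∘ h)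
  𝔼-const (pushforward h P) = 𝔼-const P
  𝔼-swap (pushforward h P) L f = 𝔼-swap P L (f ∘ h)

_⊗_ : {X Y : Set} → Expectation X → Expectation Y → Expectation (X × Y)
𝔼 (P ⊗ Q) f = 𝔼 P (λ x → 𝔼 Q (λ y → f (x , y)))
isLinear (P ⊗ Q) = record
  { 𝔼-cong = λ f≗g → 𝔼-cong P (λ x → 𝔼-cong Q (λ y → f≗g (x , y)))
  ; 𝔼-+    = λ f g → trans (𝔼-cong P (λ x → 𝔼-+ Q _ _)) (𝔼-+ P _ _)
  ; 𝔼-*    = λ c f → trans (𝔼-cong P (λ x → 𝔼-* Q c _)) (𝔼-* P c _)
  }
𝔼-mono (P ⊗ Q) f≤g = 𝔼-mono P (λ x → 𝔼-mono Q (λ y → f≤g (x , y)))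
𝔼-const (P ⊗ Q) c = trans (𝔼-cong P (λ x → 𝔼-const Q c)) (𝔼-const P c)
𝔼-swap (P ⊗ Q) L f = trans (𝔼-cong P (λ x → 𝔼-swap Q L _)) (𝔼-swap P L _)

𝔼-⊗-* : {X Y : Set} (P : Expectation X) (Q : Expectation Y) (f : X → ℚ) (g : Y → ℚ) →
        𝔼 (P ⊗ Q) (λ (x , y) → f x * g y) ≡ 𝔼 P f * 𝔼 Q g
𝔼-⊗-* P Q f g = trans (𝔼-cong P (λ x → 𝔼-* Q (f x) g)) (𝔼-*ʳ P (𝔼 Q g) f)

module _ {X : Set} (P : Expectation X) where

  𝔼[f]²≤𝔼[f²] : (f : X → ℚ) → 𝔼 P f * 𝔼 P f ≤ 𝔼 P (λ x → f x * f x)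
  𝔼[f]²≤𝔼[f²] f = begin
    μ * μ                                                ≡⟨ +-identityˡ (μ * μ) ⟨
    0ℚ + μ * μ                                           ≤⟨ +-monoˡ-≤ (μ * μ) 0≤variance ⟩
    𝔼 P (λ x → (f x - μ) * (f x - μ)) + μ * μ            ≡⟨ cong (_+ μ * μ) (𝔼-cong P (λ x → expand (f x) μ)) ⟩
    𝔼 P (λ x → f x * f x + (- (μ + μ)) * f x + μ * μ) + μ * μ
      ≡⟨ cong (_+ μ * μ) (trans (𝔼-+ P _ _) (cong₂ _+_ (𝔼-+ P _ _) (𝔼-const P _))) ⟩
    𝔼 P (λ x → f x * f x) + 𝔼 P (λ x → (- (μ + μ)) * f x) + μ * μ + μ * μ
      ≡⟨ cong (λ z → 𝔼 P (λ x → f x * f x) + z + μ * μ + μ * μ) (𝔼-* P (- (μ + μ)) f) ⟩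
    𝔼 P (λ x → f x * f x) + (- (μ + μ)) * μ + μ * μ + μ * μ ≡⟨ cancel (𝔼 P (λ x → f x * f x)) μ ⟩
    𝔼 P (λ x → f x * f x)                                ∎
    where
    open ≤-Reasoning
    μ = 𝔼 P f
    0≤variance : 0ℚ ≤ 𝔼 P (λ x → (f x - μ) * (f x - μ))
    0≤variance = subst (_≤ 𝔼 P (λ x → (f x - μ) * (f x - μ))) (𝔼-const P 0ℚ) (𝔼-mono P (λ x → 0≤p*p (f x - μ)))
    expand : ∀ a m → (a - m) * (a - m) ≡ a * a + (- (m + m)) * a + m * m
    expand = solve-∀ ℚ-ring
    cancel : ∀ a m → a + (- (m + m)) * m + m * m + m * m ≡ a
    cancel = solve-∀ ℚ-ring

coin : ∀ η → 0ℚ ≤ η → η ≤ 1ℚ → Expectation Bool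
𝔼 (coin η _ _) g = (1ℚ - η) * g false + η * g true
isLinear (coin η _ _) = record
  { 𝔼-cong = λ f≗g → cong₂ (λ u v → (1ℚ - η) * u + η * v) (f≗g false) (f≗g true)
  ; 𝔼-+    = λ f g → mix-+ η (f false) (f true) (g false) (g true)
  ; 𝔼-*    = λ c f → mix-* η c (f false) (f true)
  }
  where
  mix-+ : ∀ η a b c d → (1ℚ - η) * (a + c) + η * (b + d) ≡ ((1ℚ - η) * a + η * b) + ((1ℚ - η) * c + η * d)
  mix-+ = solve-∀ ℚ-ring
  mix-* : ∀ η c a b → (1ℚ - η) * (c * a) + η * (c * b) ≡ c * ((1ℚ - η) * a + η * b)
  mix-* = solve-∀ ℚ-ring
𝔼-mono (coin η 0≤η η≤1) f≤g =
  +-mono-≤ (*-monoˡ-≤-nonNeg (1ℚ - η) {{nonNegative (p≤q⇒0≤q-p η≤1)}} (f≤g false))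
           (*-monoˡ-≤-nonNeg η {{nonNegative 0≤η}} (f≤g true))
𝔼-const (coin η _ _) c = mix-const η c
  where
  mix-const : ∀ η c → (1ℚ - η) * c + η * c ≡ c
  mix-const = solve-∀ ℚ-ring
𝔼-swap (coin η _ _) {E = E} L f = begin
  (1ℚ - η) * E (f false) + η * E (f true)                 ≡⟨ cong₂ _+_ (L.𝔼-* (1ℚ - η) (f false)) (L.𝔼-* η (f true)) ⟨
  E (λ y → (1ℚ - η) * f false y) + E (λ y → η * f true y) ≡⟨ L.𝔼-+ _ _ ⟨
  E (λ y → (1ℚ - η) * f false y + η * f true y)           ∎
  where module L = IsLinear L; open ≡-Reasoning

module _ (η : ℚ) (0≤η : 0ℚ ≤ η) (η≤1 : η ≤ 1ℚ) where

  coins : ∀ n → Expectation (Vec Bool n)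
  coins zero    = dirac []
  coins (suc n) = pushforward (uncurry _∷_) (coin η 0≤η η≤1 ⊗ coins n)

  EBern≡coins : ∀ n f → EBern η n f ≡ 𝔼 (coins n) f
  EBern≡coins zero    f = refl
  EBern≡coins (suc n) f = cong₂ (λ u v → (1ℚ - η) * u + η * v) (EBern≡coins n _) (EBern≡coins n _)

  bernoulli : ∀ n → Expectation (Vec Bool n)
  bernoulli n = replaceOperator (coins n) (EBern η n) (EBern≡coins n)

EU≡EBern½ : ∀ n f → EU n f ≡ EBern ½ n f
EU≡EBern½ zero    f = refl
EU≡EBern½ (suc n) f = trans (cong₂ (λ u v → ½ * (u + v)) (EU≡EBern½ n _) (EU≡EBern½ n _))
                            (average≡mix (EBern ½ n (λ v → f (false ∷ v))) (EBern ½ n (λ v → f (true ∷ v))))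
  where
  average≡mix : ∀ a b → ½ * (a + b) ≡ (1ℚ - ½) * a + ½ * b
  average≡mix = solve-∀ ℚ-ring

uniform : ∀ n → Expectation (Vec Bool n)
uniform n = replaceOperator (bernoulli ½ (≤ᵇ⇒≤ _) (≤ᵇ⇒≤ _) n) (EU n) (EU≡EBern½ n)

-- Boolean groups and averaging over subgroups

record BooleanGroup : Set₁ where
  infixl 6 _∙_
  field
    Carrier        : Set
    _∙_            : Carrier → Carrier → Carrier
    ∙-assoc        : ∀ x y z → (x ∙ y) ∙ z ≡ x ∙ (y ∙ z)
    ∙-comm         : ∀ x y → x ∙ y ≡ y ∙ x
    ∙-cancelʳ      : ∀ x y → (x ∙ y) ∙ y ≡ x
    haar           : Expectation Carrier
    haar-invariant : ∀ (f : Carrier → ℚ) y → 𝔼 haar (λ x → f (x ∙ y)) ≡ 𝔼 haar f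

  ∙-interchange : ∀ w x y z → (w ∙ x) ∙ (y ∙ z) ≡ (w ∙ y) ∙ (x ∙ z)
  ∙-interchange w x y z = begin
    (w ∙ x) ∙ (y ∙ z)  ≡⟨ ∙-assoc w x (y ∙ z) ⟩
    w ∙ (x ∙ (y ∙ z))  ≡⟨ cong (w ∙_) (∙-assoc x y z) ⟨
    w ∙ ((x ∙ y) ∙ z)  ≡⟨ cong (λ v → w ∙ (v ∙ z)) (∙-comm x y) ⟩
    w ∙ ((y ∙ x) ∙ z)  ≡⟨ cong (w ∙_) (∙-assoc y x z) ⟩
    w ∙ (y ∙ (x ∙ z))  ≡⟨ ∙-assoc w y (x ∙ z) ⟨
    (w ∙ y) ∙ (x ∙ z)  ∎
    where open ≡-Reasoning

  ∙-cancel-middle : ∀ x y z → (x ∙ y) ∙ (z ∙ y) ≡ x ∙ z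
  ∙-cancel-middle x y z =
    trans (∙-interchange x y z y) (trans (sym (∙-assoc (x ∙ z) y y)) (∙-cancelʳ (x ∙ z) y))

open BooleanGroup using (haar)

_×ᴮ_ : BooleanGroup → BooleanGroup → BooleanGroup
G ×ᴮ H = record
  { Carrier        = G.Carrier × H.Carrier
  ; _∙_            = λ (x , y) (x' , y') → (x G.∙ x' , y H.∙ y')
  ; ∙-assoc        = λ (x , y) (x' , y') (x'' , y'') → cong₂ _,_ (G.∙-assoc x x' x'') (H.∙-assoc y y' y'')
  ; ∙-comm         = λ (x , y) (x' , y') → cong₂ _,_ (G.∙-comm x x') (H.∙-comm y y')
  ; ∙-cancelʳ      = λ (x , y) (x' , y') → cong₂ _,_ (G.∙-cancelʳ x x') (H.∙-cancelʳ y y')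
  ; haar           = G.haar ⊗ H.haar
  ; haar-invariant = λ f (x' , y') →
      trans (𝔼-cong G.haar (λ x → H.haar-invariant (λ y → f (x G.∙ x' , y)) y'))
            (G.haar-invariant (λ x → 𝔼 H.haar (λ y → f (x , y))) x')
  }
  where module G = BooleanGroup G; module H = BooleanGroup H

module Averaging (Y T : BooleanGroup) where
  private
    module Y = BooleanGroup Y
    module T = BooleanGroup T
    open Y using (_∙_)

  module _ (L : T.Carrier → Y.Carrier) (c : Y.Carrier → ℚ) where

    average : Y.Carrier → ℚ
    average y = 𝔼 T.haar (λ t → c (y ∙ L t))

    𝔼-average : 𝔼 Y.haar average ≡ 𝔼 Y.haar c
    𝔼-average = begin
      𝔼 Y.haar (λ y → 𝔼 T.haar (λ t → c (y ∙ L t)))  ≡⟨ 𝔼-swap Y.haar (isLinear T.haar) _ ⟩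
      𝔼 T.haar (λ t → 𝔼 Y.haar (λ y → c (y ∙ L t)))  ≡⟨ 𝔼-cong T.haar (λ t → Y.haar-invariant c (L t)) ⟩
      𝔼 T.haar (λ _ → 𝔼 Y.haar c)                    ≡⟨ 𝔼-const T.haar _ ⟩
      𝔼 Y.haar c                                     ∎
      where open ≡-Reasoning

    -- Averaging over the subgroup L(T) is an orthogonal projection.
    𝔼-average² : (∀ t t' → L (t T.∙ t') ≡ L t ∙ L t') →
                 𝔼 Y.haar (λ y → average y * average y) ≡ 𝔼 Y.haar (λ y → c y * average y)
    𝔼-average² L-hom = begin
      𝔼 Y.haar (λ y → average y * average y)
        ≡⟨ 𝔼-cong Y.haar (λ y → trans (sym (𝔼-* T.haar (average y) _))
                                      (𝔼-cong T.haar (λ t' → sym (𝔼-*ʳ T.haar (c (y ∙ L t')) _)))) ⟩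
      𝔼 Y.haar (λ y → 𝔼 T.haar (λ t' → 𝔼 T.haar (λ t → c (y ∙ L t) * c (y ∙ L t'))))
        ≡⟨ 𝔼-swap Y.haar (isLinear T.haar) _ ⟩
      𝔼 T.haar (λ t' → 𝔼 Y.haar (λ y → 𝔼 T.haar (λ t → c (y ∙ L t) * c (y ∙ L t'))))
        ≡⟨ 𝔼-cong T.haar (λ t' → sym (shift t')) ⟩
      𝔼 T.haar (λ t' → 𝔼 Y.haar (λ y → 𝔼 T.haar (λ t →
          c ((y ∙ L t') ∙ L (t T.∙ t')) * c ((y ∙ L t') ∙ L t'))))
        ≡⟨ 𝔼-cong T.haar (λ t' → 𝔼-cong Y.haar (λ y → 𝔼-cong T.haar (λ t →
             cong₂ _*_ (cong c (trans (cong ((y ∙ L t') ∙_) (L-hom t t')) (Y.∙-cancel-middle y (L t') (L t))))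
                       (cong c (Y.∙-cancelʳ y (L t')))))) ⟩
      𝔼 T.haar (λ _ → 𝔼 Y.haar (λ y → 𝔼 T.haar (λ t → c (y ∙ L t) * c y)))
        ≡⟨ 𝔼-const T.haar _ ⟩
      𝔼 Y.haar (λ y → 𝔼 T.haar (λ t → c (y ∙ L t) * c y))
        ≡⟨ 𝔼-cong Y.haar (λ y → trans (𝔼-*ʳ T.haar (c y) _) (*-comm (average y) (c y))) ⟩
      𝔼 Y.haar (λ y → c y * average y) ∎
      where
      open ≡-Reasoning
      shift : ∀ t' → 𝔼 Y.haar (λ y → 𝔼 T.haar (λ t → c ((y ∙ L t') ∙ L (t T.∙ t')) * c ((y ∙ L t') ∙ L t')))
                   ≡ 𝔼 Y.haar (λ y → 𝔼 T.haar (λ t → c (y ∙ L t) * c (y ∙ L t')))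
      shift t' = trans (𝔼-cong Y.haar (λ y → T.haar-invariant (λ t → c ((y ∙ L t') ∙ L t) * c ((y ∙ L t') ∙ L t')) t'))
                       (Y.haar-invariant (λ y → 𝔼 T.haar (λ t → c (y ∙ L t) * c (y ∙ L t'))) (L t'))

  square-mean≤correlation :
    (M N : T.Carrier → Y.Carrier) →
    (∀ t t' → M (t T.∙ t') ≡ M t ∙ M t') → (∀ t t' → N (t T.∙ t') ≡ N t ∙ N t') →
    (c : Y.Carrier → ℚ) →
    𝔼 Y.haar c * 𝔼 Y.haar c ≤ 𝔼 T.haar (λ t → 𝔼 Y.haar (λ y → c (y ∙ M t) * c (y ∙ N t)))
  square-mean≤correlation M N M-hom N-hom c = begin
    𝔼 Y.haar c * 𝔼 Y.haar c                                     ≡⟨ cong₂ _*_ 𝔼-P 𝔼-P ⟨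
    𝔼 Y.haar P * 𝔼 Y.haar P                                     ≤⟨ 𝔼[f]²≤𝔼[f²] Y.haar P ⟩
    𝔼 Y.haar (λ y → P y * P y)                                  ≡⟨ 𝔼-average² L c L-hom ⟩
    𝔼 Y.haar (λ y → c y * P y)                                  ≡⟨ 𝔼-cong Y.haar (λ y → 𝔼-* T.haar (c y) _) ⟨
    𝔼 Y.haar (λ y → 𝔼 T.haar (λ t → c y * c (y ∙ L t)))         ≡⟨ 𝔼-swap Y.haar (isLinear T.haar) _ ⟩
    𝔼 T.haar (λ t → 𝔼 Y.haar (λ y → c y * c (y ∙ L t)))         ≡⟨ 𝔼-cong T.haar shift ⟨
    𝔼 T.haar (λ t → 𝔼 Y.haar (λ y → c (y ∙ M t) * c (y ∙ N t))) ∎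
    where
    open ≤-Reasoning
    L : T.Carrier → Y.Carrier
    L t = M t ∙ N t
    L-hom : ∀ t t' → L (t T.∙ t') ≡ L t ∙ L t'
    L-hom t t' = trans (cong₂ _∙_ (M-hom t t') (N-hom t t')) (Y.∙-interchange (M t) (M t') (N t) (N t'))
    P = average L c
    𝔼-P = 𝔼-average L c
    shift : ∀ t → 𝔼 Y.haar (λ y → c (y ∙ M t) * c (y ∙ N t)) ≡ 𝔼 Y.haar (λ y → c y * c (y ∙ L t))
    shift t = trans (sym (Y.haar-invariant (λ y → c (y ∙ M t) * c (y ∙ N t)) (M t)))
                    (𝔼-cong Y.haar (λ y → cong₂ _*_ (cong c (Y.∙-cancelʳ y (M t))) (cong c (Y.∙-assoc y (M t) (N t)))))

⊕-cancelʳ : ∀ {n} (u v : Vec Bool n) → (u ⊕ v) ⊕ v ≡ u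
⊕-cancelʳ []      []      = refl
⊕-cancelʳ (a ∷ u) (b ∷ v) =
  cong₂ _∷_ (trans (xor-assoc a b b) (trans (cong (a xor_) (xor-same b)) (xor-identityʳ a))) (⊕-cancelʳ u v)

EU-invariant : ∀ n (f : Vec Bool n → ℚ) w → EU n (λ v → f (v ⊕ w)) ≡ EU n f
EU-invariant zero    f []          = refl
EU-invariant (suc n) f (false ∷ w) =
  cong₂ (λ u v → ½ * (u + v)) (EU-invariant n (f ∘ (false ∷_)) w) (EU-invariant n (f ∘ (true ∷_)) w)
EU-invariant (suc n) f (true ∷ w)  =
  trans (cong₂ (λ u v → ½ * (u + v)) (EU-invariant n (f ∘ (true ∷_)) w) (EU-invariant n (f ∘ (false ∷_)) w))
        (cong (½ *_) (+-comm (EU n (f ∘ (true ∷_))) (EU n (f ∘ (false ∷_)))))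

𝔹 : ℕ → BooleanGroup
𝔹 n = record
  { Carrier        = Vec Bool n
  ; _∙_            = _⊕_
  ; ∙-assoc        = zipWith-assoc xor-assoc
  ; ∙-comm         = zipWith-comm xor-comm
  ; ∙-cancelʳ      = ⊕-cancelʳ
  ; haar           = uniform n
  ; haar-invariant = EU-invariant n
  }

zipWith-tabulate : ∀ {A B C : Set} {n} (f : A → B → C) (g : Fin n → A) (h : Fin n → B) →
                   zipWith f (tabulate g) (tabulate h) ≡ tabulate (λ i → f (g i) (h i))
zipWith-tabulate {n = zero}  f g h = refl
zipWith-tabulate {n = suc n} f g h = cong (_ ∷_) (zipWith-tabulate f (g ∘ Fin.suc) (h ∘ Fin.suc))

proj-⊕ : ∀ {k s} (π : Fin k → Fin s) x x' → proj π (x ⊕ x') ≡ proj π x ⊕ proj π x'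
proj-⊕ π x x' = trans (tabulate-cong (λ i → lookup-zipWith _xor_ (π i) x x')) (sym (zipWith-tabulate _xor_ _ _))

_∧ᵥ_ : ∀ {n} → Vec Bool n → Vec Bool n → Vec Bool n
_∧ᵥ_ = zipWith _∧_

∧ᵥ-distribˡ-⊕ : ∀ {n} (r u v : Vec Bool n) → r ∧ᵥ (u ⊕ v) ≡ (r ∧ᵥ u) ⊕ (r ∧ᵥ v)
∧ᵥ-distribˡ-⊕ = zipWith-distribˡ ∧-distribˡ-xor

F-⊕𝟏 : ∀ {m} (θ : Vec Bool (suc m)) → F (θ ⊕ 𝟏) ≡ F θ
F-⊕𝟏 (false ∷ θ) = ⊕-cancelʳ θ 𝟏
F-⊕𝟏 (true  ∷ θ) = refl

F-⊕bOnes : ∀ {m} (θ : Vec Bool (suc m)) b → F (θ ⊕ bOnes b) ≡ F θ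
F-⊕bOnes θ false = cong F (zipWith-identityʳ xor-identityʳ θ)
F-⊕bOnes θ true  = F-⊕𝟏 θ

EU-F : ∀ m (g : Vec Bool m → ℚ) → EU (suc m) (g ∘ F) ≡ EU m g
EU-F m g = trans (cong (λ z → ½ * (EU m g + z)) (EU-invariant m g 𝟏)) (½*[p+p]≡p (EU m g))

F-⊕-⊕𝟏 : ∀ {m} (y ρ : Vec Bool (suc m)) → F (y ⊕ (ρ ⊕ 𝟏)) ≡ F (y ⊕ ρ)
F-⊕-⊕𝟏 y ρ = trans (cong F (sym (zipWith-assoc xor-assoc y ρ 𝟏))) (F-⊕𝟏 (y ⊕ ρ))

-- Bernoulli noise as masked uniform noise

EBern-flip : ∀ η n (f : Vec Bool n → ℚ) → EBern η n f ≡ EBern (1ℚ - η) n (λ ρ → f (ρ ⊕ 𝟏))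
EBern-flip η zero    f = refl
EBern-flip η (suc n) f =
  trans (swap-mix η (EBern η n (f ∘ (false ∷_))) (EBern η n (f ∘ (true ∷_))))
        (cong₂ (λ u v → (1ℚ - (1ℚ - η)) * u + (1ℚ - η) * v)
               (EBern-flip η n (f ∘ (true ∷_))) (EBern-flip η n (f ∘ (false ∷_))))
  where
  swap-mix : ∀ η a b → (1ℚ - η) * a + η * b ≡ (1ℚ - (1ℚ - η)) * b + (1ℚ - η) * a
  swap-mix = solve-∀ ℚ-ring

EBern≡EBern-∧ᵥ-uniform : ∀ {η} → 0ℚ ≤ η + η → η + η ≤ 1ℚ → ∀ n (f : Vec Bool n → ℚ) →
                        EBern η n f ≡ EBern (η + η) n (λ r → EU n (λ u → f (r ∧ᵥ u)))
EBern≡EBern-∧ᵥ-uniform                 _    _    zero    f = refl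
EBern≡EBern-∧ᵥ-uniform {η} 0≤2η 2η≤1 (suc n) f = sym (begin
  (1ℚ - (η + η)) * 𝔼 B (λ r → ½ * (P r + P r)) + (η + η) * 𝔼 B (λ r → ½ * (P r + Q r))
    ≡⟨ cong₂ (λ u v → (1ℚ - (η + η)) * u + (η + η) * v)
             (𝔼-cong B (λ r → ½*[p+p]≡p (P r)))
             (trans (𝔼-* B ½ _) (cong (½ *_) (𝔼-+ B P Q))) ⟩
  (1ℚ - (η + η)) * 𝔼 B P + (η + η) * (½ * (𝔼 B P + 𝔼 B Q))
    ≡⟨ regroup η (𝔼 B P) (𝔼 B Q) ⟩
  (1ℚ - η) * 𝔼 B P + η * 𝔼 B Q
    ≡⟨ cong₂ (λ u v → (1ℚ - η) * u + η * v)
             (EBern≡EBern-∧ᵥ-uniform 0≤2η 2η≤1 n (f ∘ (false ∷_)))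
             (EBern≡EBern-∧ᵥ-uniform 0≤2η 2η≤1 n (f ∘ (true ∷_))) ⟨
  (1ℚ - η) * EBern η n (f ∘ (false ∷_)) + η * EBern η n (f ∘ (true ∷_)) ∎)
  where
  open ≡-Reasoning
  B = bernoulli (η + η) 0≤2η 2η≤1 n
  P Q : Vec Bool n → ℚ
  P r = EU n (λ u → f (false ∷ (r ∧ᵥ u)))
  Q r = EU n (λ u → f (true ∷ (r ∧ᵥ u)))
  regroup : ∀ η a b → (1ℚ - (η + η)) * a + (η + η) * (½ * (a + b)) ≡ (1ℚ - η) * a + η * b
  regroup = solve-∀ ℚ-ring

record MaskedUniform (η : ℚ) : Set where
  field
    θ            : ℚ
    0≤θ          : 0ℚ ≤ θ
    θ≤1          : θ ≤ 1ℚ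
    EBern≡masked : ∀ {n} (f : Vec Bool n → ℚ) → (∀ ρ → f (ρ ⊕ 𝟏) ≡ f ρ) →
                   EBern η n f ≡ EBern θ n (λ r → EU n (λ u → f (r ∧ᵥ u)))

maskedUniform-≤½ : ∀ {η η'} → 0ℚ ≤ η' → η' ≤ ½ →
                   (∀ {n} (f : Vec Bool n → ℚ) → (∀ ρ → f (ρ ⊕ 𝟏) ≡ f ρ) → EBern η n f ≡ EBern η' n f) →
                   MaskedUniform η
maskedUniform-≤½ {η' = η'} 0≤η' η'≤½ EBern≡ = record
  { θ            = η' + η'
  ; 0≤θ          = 0≤2η'
  ; θ≤1          = 2η'≤1
  ; EBern≡masked = λ f f-inv → trans (EBern≡ f f-inv) (EBern≡EBern-∧ᵥ-uniform 0≤2η' 2η'≤1 _ f)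
  }
  where
  0≤2η' = +-mono-≤ 0≤η' 0≤η'
  2η'≤1 = +-mono-≤ η'≤½ η'≤½

-- Functions invariant under ⊕ 𝟏 cannot tell Bernoulli(η) from Bernoulli(1 - η), so η ≤ ½ may be assumed.
maskedUniform : ∀ {η} → 0ℚ ≤ η → η ≤ 1ℚ → MaskedUniform η
maskedUniform {η} 0≤η η≤1 with ≤-total η ½
... | inj₁ η≤½ = maskedUniform-≤½ 0≤η η≤½ (λ _ _ → refl)
... | inj₂ ½≤η = maskedUniform-≤½ 0≤1-η 1-η≤½ (λ f f-inv → trans (EBern-flip η _ f) (𝔼-cong B₁₋η f-inv))
  where
  0≤1-η : 0ℚ ≤ 1ℚ - η
  0≤1-η = p≤q⇒0≤q-p η≤1
  1-η≤½ : 1ℚ - η ≤ ½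
  1-η≤½ = +-monoʳ-≤ 1ℚ (neg-antimono-≤ ½≤η)
  B₁₋η : ∀ {n} → Expectation (Vec Bool n)
  B₁₋η = bernoulli (1ℚ - η) 0≤1-η (≤-trans 1-η≤½ (≤ᵇ⇒≤ _)) _

module _ {η} (0≤η : 0ℚ ≤ η) (η≤1 : η ≤ 1ℚ) where
  open MaskedUniform (maskedUniform 0≤η η≤1)

  bernoulli²≡masked : ∀ {n} (g : Vec Bool n × Vec Bool n → ℚ) →
    (∀ ρ₁ ρ₂ → g (ρ₁ ⊕ 𝟏 , ρ₂) ≡ g (ρ₁ , ρ₂)) → (∀ ρ₁ ρ₂ → g (ρ₁ , ρ₂ ⊕ 𝟏) ≡ g (ρ₁ , ρ₂)) →
    𝔼 (bernoulli η 0≤η η≤1 n ⊗ bernoulli η 0≤η η≤1 n) g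
      ≡ 𝔼 (bernoulli θ 0≤θ θ≤1 n ⊗ bernoulli θ 0≤θ θ≤1 n)
          (λ (r₁ , r₂) → 𝔼 (uniform n ⊗ uniform n) (λ (u₁ , u₂) → g (r₁ ∧ᵥ u₁ , r₂ ∧ᵥ u₂)))
  bernoulli²≡masked {n} g g-inv₁ g-inv₂ = begin
    EBern η n (λ ρ₁ → EBern η n (λ ρ₂ → g (ρ₁ , ρ₂)))
      ≡⟨ 𝔼-cong Bη (λ ρ₁ → EBern≡masked (λ ρ₂ → g (ρ₁ , ρ₂)) (g-inv₂ ρ₁)) ⟩
    EBern η n (λ ρ₁ → EBern θ n (λ r₂ → EU n (λ u₂ → g (ρ₁ , r₂ ∧ᵥ u₂))))
      ≡⟨ EBern≡masked _ (λ ρ₁ → 𝔼-cong Bθ (λ r₂ → 𝔼-cong (uniform n) (λ u₂ → g-inv₁ ρ₁ (r₂ ∧ᵥ u₂)))) ⟩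
    EBern θ n (λ r₁ → EU n (λ u₁ → EBern θ n (λ r₂ → EU n (λ u₂ → g (r₁ ∧ᵥ u₁ , r₂ ∧ᵥ u₂)))))
      ≡⟨ 𝔼-cong Bθ (λ r₁ → 𝔼-swap (uniform n) (isLinear Bθ) _) ⟩
    EBern θ n (λ r₁ → EBern θ n (λ r₂ → EU n (λ u₁ → EU n (λ u₂ → g (r₁ ∧ᵥ u₁ , r₂ ∧ᵥ u₂))))) ∎
    where
    open ≡-Reasoning
    Bη = bernoulli η 0≤η η≤1 n
    Bθ = bernoulli θ 0≤θ θ≤1 n

module FourQueryTest (m s : ℕ) (π₁ π₂ : Fin (suc m) → Fin s) (A B : Vec Bool m → Bool) where
  k = suc m

  𝕐 𝕋 : BooleanGroup
  𝕐 = 𝔹 k ×ᴮ 𝔹 k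
  𝕋 = 𝔹 s ×ᴮ 𝕐

  open BooleanGroup 𝕐 using (_∙_; haar-invariant)
  open BooleanGroup 𝕋 using () renaming (_∙_ to _∙𝕋_)
  open Averaging 𝕐 𝕋 using (square-mean≤correlation)

  α β : ℚ
  α = density m A
  β = density m B

  c : Vec Bool k × Vec Bool k → ℚ
  c (y₁ , y₂) = 𝟙 (A (F y₁) ∧ B (F y₂))

  𝔼-c : 𝔼 (haar 𝕐) c ≡ α * β
  𝔼-c = trans (𝔼-cong (haar 𝕐) (λ (y₁ , y₂) → 𝟙-∧ (A (F y₁)) (B (F y₂))))
              (trans (𝔼-⊗-* (uniform k) (uniform k) (𝟙 ∘ A ∘ F) (𝟙 ∘ B ∘ F))
                     (cong₂ _*_ (EU-F m (𝟙 ∘ A)) (EU-F m (𝟙 ∘ B))))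

  project : Vec Bool s → Vec Bool k × Vec Bool k
  project x = (proj π₁ x , proj π₂ x)

  acceptᵇ : Vec Bool s → Vec Bool k × Vec Bool k → Vec Bool k × Vec Bool k → Bool → ℚ
  acceptᵇ x (y₁ , y₂) (ρ₁ , ρ₂) b =
    𝟙 (A (F (y₁ ⊕ ρ₁)) ∧ A (F (proj π₁ x ⊕ y₁)) ∧ B (F (y₂ ⊕ ρ₂)) ∧ B (F ((proj π₂ x ⊕ y₂) ⊕ bOnes b)))

  accept : Vec Bool s → Vec Bool k × Vec Bool k → Vec Bool k × Vec Bool k → ℚ
  accept x (y₁ , y₂) (ρ₁ , ρ₂) =
    𝟙 (A (F (y₁ ⊕ ρ₁)) ∧ A (F (proj π₁ x ⊕ y₁)) ∧ B (F (y₂ ⊕ ρ₂)) ∧ B (F (proj π₂ x ⊕ y₂)))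

  accept≡c*c : ∀ x y ρ → accept x y ρ ≡ c (y ∙ project x) * c (y ∙ ρ)
  accept≡c*c x (y₁ , y₂) (ρ₁ , ρ₂) = begin
    𝟙 (a₁ ∧ a₂ ∧ b₁ ∧ b₂)      ≡⟨ cong 𝟙 (regroup a₁ a₂ b₁ b₂) ⟩
    𝟙 ((a₂ ∧ b₂) ∧ (a₁ ∧ b₁))  ≡⟨ 𝟙-∧ (a₂ ∧ b₂) (a₁ ∧ b₁) ⟩
    𝟙 (a₂ ∧ b₂) * 𝟙 (a₁ ∧ b₁)  ≡⟨ cong (λ z → c z * 𝟙 (a₁ ∧ b₁)) (cong₂ _,_ (⊕-comm (proj π₁ x) y₁) (⊕-comm (proj π₂ x) y₂)) ⟩
    c (y₁ ⊕ proj π₁ x , y₂ ⊕ proj π₂ x) * 𝟙 (a₁ ∧ b₁) ∎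
    where
    open ≡-Reasoning
    ⊕-comm = zipWith-comm xor-comm
    a₁ = A (F (y₁ ⊕ ρ₁))
    a₂ = A (F (proj π₁ x ⊕ y₁))
    b₁ = B (F (y₂ ⊕ ρ₂))
    b₂ = B (F (proj π₂ x ⊕ y₂))
    regroup : ∀ p q r t → (p ∧ q ∧ r ∧ t) ≡ (q ∧ t) ∧ (p ∧ r)
    regroup false q     r t = sym (∧-zeroʳ (q ∧ t))
    regroup true  false r t = refl
    regroup true  true  r t = ∧-comm r t

  accept-flip₁ : ∀ x y ρ₁ ρ₂ → accept x y (ρ₁ ⊕ 𝟏 , ρ₂) ≡ accept x y (ρ₁ , ρ₂)
  accept-flip₁ x (y₁ , y₂) ρ₁ ρ₂ = cong (λ z → 𝟙 (A z ∧ A (F (proj π₁ x ⊕ y₁)) ∧ B (F (y₂ ⊕ ρ₂)) ∧ B (F (proj π₂ x ⊕ y₂))))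
                                        (F-⊕-⊕𝟏 y₁ ρ₁)

  accept-flip₂ : ∀ x y ρ₁ ρ₂ → accept x y (ρ₁ , ρ₂ ⊕ 𝟏) ≡ accept x y (ρ₁ , ρ₂)
  accept-flip₂ x (y₁ , y₂) ρ₁ ρ₂ = cong (λ z → 𝟙 (A (F (y₁ ⊕ ρ₁)) ∧ A (F (proj π₁ x ⊕ y₁)) ∧ B z ∧ B (F (proj π₂ x ⊕ y₂))))
                                        (F-⊕-⊕𝟏 y₂ ρ₂)

  accept≤c : ∀ x y ρ → accept x y ρ ≤ c (y ∙ project x)
  accept≤c x y ρ = subst (_≤ c (y ∙ project x)) (sym (accept≡c*c x y ρ)) (p*q≤p (0≤c (y ∙ project x)) (c≤1 (y ∙ ρ)))
    where
    0≤c : ∀ y → 0ℚ ≤ c y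
    0≤c (y₁ , y₂) = 0≤𝟙 (A (F y₁) ∧ B (F y₂))
    c≤1 : ∀ y → c y ≤ 1ℚ
    c≤1 (y₁ , y₂) = 𝟙≤1 (A (F y₁) ∧ B (F y₂))

  maskedAccept : Vec Bool s → Vec Bool k × Vec Bool k → Vec Bool k × Vec Bool k → ℚ
  maskedAccept x y (r₁ , r₂) = 𝔼 (haar 𝕐) (λ (u₁ , u₂) → accept x y (r₁ ∧ᵥ u₁ , r₂ ∧ᵥ u₂))

  maskedAccept-correlation : ∀ r → (α * β) * (α * β) ≤ 𝔼 (uniform s) (λ x → 𝔼 (haar 𝕐) (λ y → maskedAccept x y r))
  maskedAccept-correlation (r₁ , r₂) = begin
    (α * β) * (α * β)                                                  ≡⟨ cong₂ _*_ 𝔼-c 𝔼-c ⟨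
    𝔼 (haar 𝕐) c * 𝔼 (haar 𝕐) c                                        ≤⟨ square-mean≤correlation M N M-hom N-hom c ⟩
    𝔼 (haar 𝕋) (λ t → 𝔼 (haar 𝕐) (λ y → c (y ∙ M t) * c (y ∙ N t)))
      ≡⟨ 𝔼-cong (haar 𝕋) (λ t → 𝔼-cong (haar 𝕐) (λ y → accept≡c*c (proj₁ t) y (N t))) ⟨
    𝔼 (uniform s) (λ x → 𝔼 (haar 𝕐) (λ u → 𝔼 (haar 𝕐) (λ y → accept x y (N (x , u)))))
      ≡⟨ 𝔼-cong (uniform s) (λ x → 𝔼-swap (haar 𝕐) (isLinear (haar 𝕐)) (λ y u → accept x y (N (x , u)))) ⟨
    𝔼 (uniform s) (λ x → 𝔼 (haar 𝕐) (λ y → 𝔼 (haar 𝕐) (λ u → accept x y (N (x , u)))))  ∎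
    where
    open ≤-Reasoning
    M N : Vec Bool s × (Vec Bool k × Vec Bool k) → Vec Bool k × Vec Bool k
    M (x , _) = project x
    N (_ , (u₁ , u₂)) = (r₁ ∧ᵥ u₁ , r₂ ∧ᵥ u₂)
    M-hom : ∀ t t' → M (t ∙𝕋 t') ≡ M t ∙ M t'
    M-hom (x , _) (x' , _) = cong₂ _,_ (proj-⊕ π₁ x x') (proj-⊕ π₂ x x')
    N-hom : ∀ t t' → N (t ∙𝕋 t') ≡ N t ∙ N t'
    N-hom (_ , (u₁ , u₂)) (_ , (u₁' , u₂')) = cong₂ _,_ (∧ᵥ-distribˡ-⊕ r₁ u₁ u₁') (∧ᵥ-distribˡ-⊕ r₂ u₂ u₂')

  module _ {η} (0≤η : 0ℚ ≤ η) (η≤1 : η ≤ 1ℚ) where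
    Bη² : Expectation (Vec Bool k × Vec Bool k)
    Bη² = bernoulli η 0≤η η≤1 k ⊗ bernoulli η 0≤η η≤1 k

    testAccept≡ : testAccept m s η π₁ π₂ A B ≡ 𝔼 (uniform s) (λ x → 𝔼 (haar 𝕐) (λ y → 𝔼 Bη² (accept x y)))
    testAccept≡ = 𝔼-cong (uniform s) λ x → 𝔼-cong (haar 𝕐) λ y → 𝔼-cong Bη² λ ρ →
      trans (cong₂ (λ u v → ½ * (u + v)) (bit-irrelevant x y ρ false) (bit-irrelevant x y ρ true))
            (½*[p+p]≡p (accept x y ρ))
      where
      bit-irrelevant : ∀ x y ρ b → acceptᵇ x y ρ b ≡ accept x y ρ
      bit-irrelevant x (y₁ , y₂) (ρ₁ , ρ₂) b =
        cong (λ z → 𝟙 (A (F (y₁ ⊕ ρ₁)) ∧ A (F (proj π₁ x ⊕ y₁)) ∧ B (F (y₂ ⊕ ρ₂)) ∧ B z)) (F-⊕bOnes (proj π₂ x ⊕ y₂) b)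

    upper : testAccept m s η π₁ π₂ A B ≤ α * β
    upper = begin
      testAccept m s η π₁ π₂ A B                                                 ≡⟨ testAccept≡ ⟩
      𝔼 (uniform s) (λ x → 𝔼 (haar 𝕐) (λ y → 𝔼 Bη² (accept x y)))
        ≤⟨ 𝔼-mono (uniform s) (λ x → 𝔼-mono (haar 𝕐) (λ y → 𝔼-mono Bη² (accept≤c x y))) ⟩
      𝔼 (uniform s) (λ x → 𝔼 (haar 𝕐) (λ y → 𝔼 Bη² (λ _ → c (y ∙ project x))))
        ≡⟨ 𝔼-cong (uniform s) (λ x → 𝔼-cong (haar 𝕐) (λ y → 𝔼-const Bη² (c (y ∙ project x)))) ⟩
      𝔼 (uniform s) (λ x → 𝔼 (haar 𝕐) (λ y → c (y ∙ project x)))             ≡⟨ 𝔼-cong (uniform s) (λ x → haar-invariant c (project x)) ⟩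
      𝔼 (uniform s) (λ _ → 𝔼 (haar 𝕐) c)                                       ≡⟨ trans (𝔼-const (uniform s) _) 𝔼-c ⟩
      α * β                                                                     ∎
      where open ≤-Reasoning

    lower : (α * β) * (α * β) ≤ testAccept m s η π₁ π₂ A B
    lower = begin
      (α * β) * (α * β)                                   ≡⟨ 𝔼-const R _ ⟨
      𝔼 R (λ _ → (α * β) * (α * β))                       ≤⟨ 𝔼-mono R maskedAccept-correlation ⟩
      𝔼 R (λ r → 𝔼 (uniform s) (λ x → 𝔼 (haar 𝕐) (λ y → maskedAccept x y r)))
        ≡⟨ 𝔼-swap (haar 𝕋) (isLinear R) (λ (x , y) → maskedAccept x y) ⟨
      𝔼 (uniform s) (λ x → 𝔼 (haar 𝕐) (λ y → 𝔼 R (maskedAccept x y)))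
        ≡⟨ 𝔼-cong (uniform s) (λ x → 𝔼-cong (haar 𝕐) (λ y →
             bernoulli²≡masked 0≤η η≤1 (accept x y) (accept-flip₁ x y) (accept-flip₂ x y))) ⟨
      𝔼 (uniform s) (λ x → 𝔼 (haar 𝕐) (λ y → 𝔼 Bη² (accept x y))) ≡⟨ testAccept≡ ⟨
      testAccept m s η π₁ π₂ A B                                  ∎
      where
      open ≤-Reasoning
      open MaskedUniform (maskedUniform 0≤η η≤1)
      R = bernoulli θ 0≤θ θ≤1 k ⊗ bernoulli θ 0≤θ θ≤1 k

lemma7p8 : (m s : ℕ) → s ≤ℕ suc m → (η : ℚ) → 0ℚ < η → η < 1ℚ →
           (π₁ π₂ : Fin (suc m) → Fin s) → (A B : Vec Bool m → Bool) →
           let α = density m A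
               β = density m B
           in  (((α * α) * (β * β)) * ½ ≤ testAccept m s η π₁ π₂ A B)
             × (testAccept m s η π₁ π₂ A B ≤ α * β)
lemma7p8 m s _ η 0<η η<1 π₁ π₂ A B = ≤-trans half (lower 0≤η η≤1) , upper 0≤η η≤1
  where
  open FourQueryTest m s π₁ π₂ A B
  0≤η = <⇒≤ 0<η
  η≤1 = <⇒≤ η<1
  regroup : ∀ a b → ((a * b) * (a * b)) * ½ ≡ ((a * a) * (b * b)) * ½
  regroup = solve-∀ ℚ-ring
  half : ((α * α) * (β * β)) * ½ ≤ (α * β) * (α * β)
  half = subst (_≤ (α * β) * (α * β)) (regroup α β) (p*q≤p (0≤p*p (α * β)) (≤ᵇ⇒≤ _))
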